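{- If $G$ is a graph and $H$ is a minor of $G$, then $l(H)\le l(G)$.
   Context: For $a\neq b$ in a finite vertex set, $(a\to b)$ denotes the transformation mapping $a$ to $b$ and fixing every other point; transformations are composed left to right. For a digraph $D$ (no loops, no multiple arcs), $\langle D\rangle$ is the semigroup generated by all $(a\to b)$ with $(a,b)$ an arc. A graph is a digraph in which $(u,v)$ is an arc iff $(v,u)$ is. A cycle of length $k$ of a transformation $\alpha$ is a sequence of distinct points $a_0,\ldots,a_{k-1}$ with $a_i\alpha=a_{i+1}$ (indices mod $k$); $l(\alpha)$ is the length of a longest cycle of $\alpha$, and $l(D)=\max\{l(\alpha):\alpha\in\langle D\rangle\}$. A minor of $G$ is a graph obtained from $G$ by successively deleting vertices, deleting edges, or contracting edges. -}

module Defs where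

open import Data.Nat using (ℕ; zero; suc; _≤_)
open import Data.Nat.DivMod using (_%_; m%n<n)
open import Data.Fin using (Fin; toℕ; fromℕ<; punchIn; punchOut; _≟_)
open import Data.Product using (Σ; ∃; _×_; _,_)
open import Data.Empty using (⊥)
open import Data.List using (List; []; _∷_)
open import Relation.Nullary using (¬_; yes; no)
open import Relation.Binary.PropositionalEquality using (_≡_; _≢_)
open import Relation.Binary.Construct.Closure.ReflexiveTransitive using (Star)
open import Function.Bundles using (_⇔_)

-- A graph on the vertex set Fin n: a loopless symmetric arc relation
-- (no multiple arcs, since arcs form a relation).
record Graph (n : ℕ) : Set₁ where
  field
    E      : Fin n → Fin n → Set
    irrefl : ∀ i → ¬ E i i
    sym    : ∀ {i j} → E i j → E j i
open Graph public

-- Transformations of Fin n; composition is left to right: (α ; β) x = β (α x).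
Transf : ℕ → Set
Transf n = Fin n → Fin n

[_↦_] : ∀ {n} → Fin n → Fin n → Transf n
[ a ↦ b ] x with x ≟ a
... | yes _ = b
... | no  _ = x

Arc : ∀ {n} → Graph n → Set
Arc {n} G = Σ (Fin n × Fin n) λ { (a , b) → E G a b }

applyWord : ∀ {n} (G : Graph n) → List (Arc G) → Transf n
applyWord G []                    x = x
applyWord G (((a , b) , _) ∷ w)   x = applyWord G w ([ a ↦ b ] x)

InSG : ∀ {n} → Graph n → Transf n → Set
InSG {n} G α = Σ (Arc G) λ g → Σ (List (Arc G)) λ w →
  ∀ x → applyWord G (g ∷ w) x ≡ α x

nextMod : ∀ {m} → Fin (suc m) → Fin (suc m)
nextMod {m} i = fromℕ< (m%n<n (suc (toℕ i)) (suc m))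

HasCycle : ∀ {n} → Transf n → ℕ → Set
HasCycle {n} α zero    = ⊥
HasCycle {n} α (suc m) = Σ (Fin (suc m) → Fin n) λ a →
  (∀ i j → a i ≡ a j → i ≡ j) × (∀ i → α (a i) ≡ a (nextMod i))

-- Contraction map for an edge uv: vertex v is merged into u,
-- the remaining vertices are renumbered by removing v.
mergeInto : ∀ {n} (u v : Fin (suc n)) → v ≢ u → Fin (suc n) → Fin n
mergeInto u v v≢u x with v ≟ x
... | yes _   = punchOut v≢u
... | no v≢x  = punchOut v≢x

GraphAny : Set₁
GraphAny = Σ ℕ Graph

data MinorStep : GraphAny → GraphAny → Set₁ where
  delVertex : ∀ {n} (G : Graph (suc n)) (H : Graph n) (v : Fin (suc n)) →
    (∀ i j → E H i j ⇔ E G (punchIn v i) (punchIn v j)) →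
    MinorStep (n , H) (suc n , G)
  delEdge : ∀ {n} (G : Graph n) (H : Graph n) (u v : Fin n) → E G u v →
    (∀ i j → E H i j ⇔ (E G i j × ¬ (i ≡ u × j ≡ v) × ¬ (i ≡ v × j ≡ u))) →
    MinorStep (n , H) (n , G)
  contract : ∀ {n} (G : Graph (suc n)) (H : Graph n) (u v : Fin (suc n)) →
    (uv : E G u v) (v≢u : v ≢ u) →
    (∀ x y → E H x y ⇔ (x ≢ y × Σ (Fin (suc n)) λ a → Σ (Fin (suc n)) λ b →
        mergeInto u v v≢u a ≡ x × mergeInto u v v≢u b ≡ y × E G a b)) →
    MinorStep (n , H) (suc n , G)

IsMinor : GraphAny → GraphAny → Set₁
IsMinor = Star MinorStep

module Submission where

-- Each single minor step H ⊑ G comes with an injective relabelling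
-- e : Fin m → Fin n of the vertices of H into those of G (the identity for edge
-- deletion, punchIn v when the vertex v is deleted or merged into u) such that
-- every generator (a → b) of ⟨H⟩ is simulated by a nonempty word of generators
-- of ⟨G⟩: on the image of e the word acts exactly as e ∘ (a → b).  For deletions
-- the single generator (e a → e b) does this; for the contraction of an edge uv,
-- an arc of H through the merged vertex is simulated by a two-letter detour
-- through the vanished vertex v, e.g. (u → v)(v → b).  Simulations extend from
-- generators to words, so every α ∈ ⟨H⟩ has a partner β ∈ ⟨G⟩ with
-- β ∘ e = e ∘ α, and e carries each cycle of α to a cycle of β of the same
-- length.  The relation "every cycle length in ⟨H⟩ is bounded by one in ⟨G⟩"
-- is reflexive and transitive, so it follows along any chain of minor steps.

open import Defs
open import Data.Nat using (ℕ; _≤_; suc)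
open import Data.Nat.Properties using (≤-refl; ≤-trans)
open import Data.Product using (Σ; _×_; _,_; proj₁)
open import Data.Sum using (_⊎_; inj₁; inj₂)
open import Data.Fin using (Fin; punchIn; _≟_)
open import Data.Fin.Properties using (punchIn-punchOut; punchInᵢ≢i; punchIn-injective)
open import Data.List using (List; []; _∷_; _++_)
open import Data.Empty using (⊥-elim)
open import Function using (_∘_)
open import Function.Definitions using (Injective)
open import Function.Bundles using (Equivalence)
open import Relation.Nullary using (yes; no)
open import Relation.Binary.PropositionalEquality
  using (_≡_; _≢_; refl; trans; cong)
open import Relation.Binary.Construct.Closure.ReflexiveTransitive using (ε; _◅_)

↦-hit : ∀ {n} (a b : Fin n) → [ a ↦ b ] a ≡ b
↦-hit a b with a ≟ a
... | yes _   = refl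
... | no a≢a  = ⊥-elim (a≢a refl)

↦-miss : ∀ {n} {a x : Fin n} (b : Fin n) → x ≢ a → [ a ↦ b ] x ≡ x
↦-miss {a = a} {x} b x≢a with x ≟ a
... | yes x≡a = ⊥-elim (x≢a x≡a)
... | no _    = refl

module Relabelling {m n} (e : Fin m → Fin n) (e-inj : Injective _≡_ _≡_ e) where

  relabel : ∀ {x y s t} → e x ≡ s → e y ≡ t →
    ∀ p → [ s ↦ t ] (e p) ≡ e ([ x ↦ y ] p)
  relabel {x} {y} refl refl p with p ≟ x
  ... | yes refl = ↦-hit (e x) (e y)
  ... | no p≢x   = ↦-miss (e y) (p≢x ∘ e-inj)

  detour : ∀ {x y s t w} → e x ≡ s → e y ≡ t → (∀ p → e p ≢ w) →
    ∀ p → [ w ↦ t ] ([ s ↦ w ] (e p)) ≡ e ([ x ↦ y ] p)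
  detour {x} {y} {w = w} refl refl w∉e p with p ≟ x
  ... | yes refl = trans (cong [ w ↦ e y ] (↦-hit (e x) w)) (↦-hit w (e y))
  ... | no p≢x   =
    trans (cong [ w ↦ e y ] (↦-miss w (p≢x ∘ e-inj))) (↦-miss (e y) (w∉e p))

generator : ∀ {n} (G : Graph n) → Arc G → Transf n
generator G ((a , b) , _) = [ a ↦ b ]

applyWord-++ : ∀ {n} (G : Graph n) (w₁ w₂ : List (Arc G)) x →
  applyWord G (w₁ ++ w₂) x ≡ applyWord G w₂ (applyWord G w₁ x)
applyWord-++ G []       w₂ x = refl
applyWord-++ G (g ∷ w₁) w₂ x = applyWord-++ G w₁ w₂ (generator G g x)

Realises : ∀ {m n} (G : Graph n) → (Fin m → Fin n) → Transf m → List (Arc G) → Set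
Realises G e f w = ∀ p → applyWord G w (e p) ≡ e (f p)

realises-++ : ∀ {m n} {G : Graph n} {e : Fin m → Fin n} {f f′ : Transf m} {w w′} →
  Realises G e f w → Realises G e f′ w′ → Realises G e (f′ ∘ f) (w ++ w′)
realises-++ {G = G} {e} {f} {w = w} {w′} w≈f w′≈f′ p =
  trans (applyWord-++ G w w′ (e p))
        (trans (cong (applyWord G w′) (w≈f p)) (w′≈f′ (f p)))

Simulation : ∀ {m n} → Graph n → Graph m → (Fin m → Fin n) → Set
Simulation G H e = (g : Arc H) →
  Σ (Arc G) λ h → Σ (List (Arc G)) λ ws → Realises G e (generator H g) (h ∷ ws)

module Lifting {m n} (G : Graph n) (H : Graph m) (e : Fin m → Fin n)
               (sim : Simulation G H e) where

  lift : List (Arc H) → List (Arc G)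
  lift []      = []
  lift (g ∷ w) = let (h , ws , _) = sim g in h ∷ ws ++ lift w

  lift-realises : ∀ w → Realises G e (applyWord H w) (lift w)
  lift-realises []      p = refl
  lift-realises (g ∷ w) =
    let (h , ws , g≈) = sim g
    in realises-++ {G = G} {e} {generator H g} {applyWord H w} {h ∷ ws} {lift w}
                   g≈ (lift-realises w)

  lift-element : ∀ α → InSG H α →
    Σ (Transf n) λ β → InSG G β × (∀ p → β (e p) ≡ e (α p))
  lift-element α (g , w , w≈α) =
    let (h , ws , _) = sim g
    in applyWord G (lift (g ∷ w)) , (h , ws ++ lift w , λ _ → refl) ,
       λ p → trans (lift-realises (g ∷ w) p) (cong e (w≈α p))

cycle-transfer : ∀ {m n} {α : Transf m} {β : Transf n} (e : Fin m → Fin n) →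
  Injective _≡_ _≡_ e → (∀ p → β (e p) ≡ e (α p)) →
  ∀ k → HasCycle α k → HasCycle β k
cycle-transfer e e-inj β∘e≡e∘α (suc k) (a , a-inj , a-cycle) =
  e ∘ a , (λ i j eai≡eaj → a-inj i j (e-inj eai≡eaj)) ,
  λ i → trans (β∘e≡e∘α (a i)) (cong e (a-cycle i))

-- CycleBound H G: every cycle length occurring in ⟨H⟩ is at most one occurring
-- in ⟨G⟩; this is the statement l(H) ≤ l(G).
CycleBound : GraphAny → GraphAny → Set
CycleBound (m , H) (n , G) = ∀ (α : Transf m) → InSG H α → ∀ (k : ℕ) → HasCycle α k →
  Σ (Transf n) λ β → InSG G β × Σ ℕ λ k′ → k ≤ k′ × HasCycle β k′

cycleBound-refl : ∀ {P} → CycleBound P P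
cycleBound-refl {_ , _} α α∈H k α-cycle = α , α∈H , k , ≤-refl , α-cycle

cycleBound-trans : ∀ {P Q R} → CycleBound P Q → CycleBound Q R → CycleBound P R
cycleBound-trans {_ , _} {_ , _} {_ , _} P≼Q Q≼R α α∈P k α-cycle =
  let (β , β∈Q , k′ , k≤k′ , β-cycle) = P≼Q α α∈P k α-cycle
      (γ , γ∈R , k″ , k′≤k″ , γ-cycle) = Q≼R β β∈Q k′ β-cycle
  in γ , γ∈R , k″ , ≤-trans k≤k′ k′≤k″ , γ-cycle

simulation⇒cycleBound : ∀ {m n} (G : Graph n) (H : Graph m) (e : Fin m → Fin n) →
  Injective _≡_ _≡_ e → Simulation G H e → CycleBound (m , H) (n , G)
simulation⇒cycleBound G H e e-inj sim α α∈H k α-cycle =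
  let (β , β∈G , β∘e≡e∘α) = Lifting.lift-element G H e sim α α∈H
  in β , β∈G , k , ≤-refl , cycle-transfer e e-inj β∘e≡e∘α k α-cycle

punchIn-mergeInto : ∀ {n} (u v : Fin (suc n)) (v≢u : v ≢ u) a →
  (v ≡ a × punchIn v (mergeInto u v v≢u a) ≡ u) ⊎
  (v ≢ a × punchIn v (mergeInto u v v≢u a) ≡ a)
punchIn-mergeInto u v v≢u a with v ≟ a
... | yes refl = inj₁ (refl , punchIn-punchOut v≢u)
... | no v≢a   = inj₂ (v≢a , punchIn-punchOut v≢a)

module Contraction {n} (G : Graph (suc n)) (u v : Fin (suc n)) (uv : E G u v)
                   (v≢u : v ≢ u) where
  open Relabelling (punchIn v) (punchIn-injective v _ _)

  -- The image (π a → π b) of an arc ab of G is simulated on the image of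
  -- punchIn v: directly if ab avoids v, by a detour through v otherwise.
  contractedArc : ∀ a b → E G a b → Σ (Arc G) λ h → Σ (List (Arc G)) λ ws →
    Realises G (punchIn v) [ mergeInto u v v≢u a ↦ mergeInto u v v≢u b ] (h ∷ ws)
  contractedArc a b ab
    with punchIn-mergeInto u v v≢u a | punchIn-mergeInto u v v≢u b
  ... | inj₁ (refl , _)  | inj₁ (refl , _)  = ⊥-elim (irrefl G v ab)
  ... | inj₁ (refl , a↑) | inj₂ (_ , b↑)    =
    ((u , v) , uv) , ((v , b) , ab) ∷ [] , detour a↑ b↑ (punchInᵢ≢i v)
  ... | inj₂ (_ , a↑)    | inj₁ (refl , b↑) =
    ((a , v) , ab) , ((v , u) , Graph.sym G uv) ∷ [] , detour a↑ b↑ (punchInᵢ≢i v)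
  ... | inj₂ (_ , a↑)    | inj₂ (_ , b↑)    = ((a , b) , ab) , [] , relabel a↑ b↑

minorStep⇒cycleBound : ∀ {P Q} → MinorStep P Q → CycleBound P Q
minorStep⇒cycleBound (delVertex G H v H⇔G) =
  simulation⇒cycleBound G H (punchIn v) (punchIn-injective v _ _)
    λ { ((a , b) , ab) → ((punchIn v a , punchIn v b) , Equivalence.to (H⇔G a b) ab) , [] ,
          Relabelling.relabel (punchIn v) (punchIn-injective v _ _) refl refl }
minorStep⇒cycleBound (delEdge G H u v _ H⇔G) =
  simulation⇒cycleBound G H (λ x → x) (λ x≡y → x≡y)
    λ { ((a , b) , ab) → ((a , b) , proj₁ (Equivalence.to (H⇔G a b) ab)) , [] , λ _ → refl }
minorStep⇒cycleBound (contract G H u v uv v≢u H⇔G) =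
  simulation⇒cycleBound G H (punchIn v) (punchIn-injective v _ _) simulate
  where
  simulate : Simulation G H (punchIn v)
  simulate ((x , y) , xy) with Equivalence.to (H⇔G x y) xy
  ... | _ , a , b , refl , refl , ab = Contraction.contractedArc G u v uv v≢u a b ab

lemma3p4 : ∀ {m n} (G : Graph n) (H : Graph m) → IsMinor (m , H) (n , G) →
    ∀ (α : Transf m) → InSG H α → ∀ (k : ℕ) → HasCycle α k →
    Σ (Transf n) λ β → InSG G β × Σ ℕ λ k′ → k ≤ k′ × HasCycle β k′
lemma3p4 G H = minor⇒cycleBound
  where
  minor⇒cycleBound : ∀ {P Q} → IsMinor P Q → CycleBound P Q
  minor⇒cycleBound ε            = cycleBound-refl
  minor⇒cycleBound (step ◅ rest) =
    cycleBound-trans (minorStep⇒cycleBound step) (minor⇒cycleBound rest)
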